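{- Let $G$ be a finite connected graph with at least two cycles, let $G_{\mathrm{int}}$ be its 2-core, and let $E^G_{\mathrm{int}}$ be the set of edges of $G_{\mathrm{int}}$ each directed both ways. Then there exists a function $\Gamma: E^G_{\mathrm{int}} \to [1,2)$ such that for every directed edge $(u,v) \in E^G_{\mathrm{int}}$, $$\sum_{\substack{w:\ (v,w)\in E^G_{\mathrm{int}}\\ w \ne u}} \Gamma(v,w) > \Gamma(u,v).$$
   Context: Graphs may have multiple edges and loops; cycles may intersect, and loops or pairs of parallel edges count as cycles. The 2-core of $G$ is the subgraph obtained by repeatedly deleting a leaf (a degree-1 vertex together with its edge) until no leaves remain. Each undirected edge $\{u,v\}$ of $G_{\mathrm{int}}$ yields the two directed edges $(u,v)$ and $(v,u)$ in $E^G_{\mathrm{int}}$; $\Gamma$ need not be symmetric. -}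

module Defs where

open import Data.Nat using (ℕ; zero; suc; _<?_; s≤s)
open import Data.Fin using (Fin; zero; suc; toℕ; fromℕ<; _≟_)
open import Data.Bool using (Bool; true; false; not; _∧_; if_then_else_)
open import Data.List using (List; []; _∷_; allFin; concatMap; foldr)
open import Data.Product using (Σ; Σ-syntax; _×_; _,_)
open import Data.Sum using (_⊎_)
open import Data.Empty using (⊥)
open import Relation.Nullary using (¬_; yes; no)
open import Relation.Nullary.Decidable using (⌊_⌋)
open import Relation.Binary.PropositionalEquality using (_≡_)
open import Relation.Binary.Construct.Closure.ReflexiveTransitive using (Star)
open import Function.Definitions using (Injective)
import Data.Rational as Q
open Q using (ℚ; 0ℚ; 1ℚ)

-- A finite multigraph (loops and parallel edges allowed): vertices Fin n,
-- edges Fin m, edge e has endpoints src e and tgt e (orientation is an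
-- arbitrary labelling; the edge is undirected).
record Graph : Set where
  field
    n m : ℕ
    src tgt : Fin m → Fin n
open Graph public

Joins : (G : Graph) → Fin (m G) → Fin (n G) → Fin (n G) → Set
Joins G e u w = (src G e ≡ u × tgt G e ≡ w) ⊎ (src G e ≡ w × tgt G e ≡ u)

data Reach (G : Graph) : Fin (n G) → Fin (n G) → Set where
  here : ∀ {u} → Reach G u u
  step : ∀ {u w v} (e : Fin (m G)) → Joins G e u w → Reach G w v → Reach G u v

Connected : Graph → Set
Connected G = ∀ u v → Reach G u v

next : ∀ {k} → Fin (suc k) → Fin (suc k)
next {k} i with suc (toℕ i) <? suc k
... | yes p = fromℕ< p
... | no _ = zero

-- A cycle of length suc k: distinct vertices vs 0..k, distinct edges es 0..k,
-- edge es i joining vs i and vs (i+1 mod (k+1)).  Length 1 = loop,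
-- length 2 = pair of parallel edges.
record Cycle (G : Graph) : Set where
  field
    k : ℕ
    vs : Fin (suc k) → Fin (n G)
    es : Fin (suc k) → Fin (m G)
    vs-inj : Injective _≡_ _≡_ vs
    es-inj : Injective _≡_ _≡_ es
    joins : ∀ i → Joins G (es i) (vs i) (vs (next i))

_∈C_ : ∀ {G} → Fin (m G) → Cycle G → Set
e ∈C C = Σ[ i ∈ Fin (suc (Cycle.k C)) ] Cycle.es C i ≡ e

-- cycles are identified with their edge sets
SameCycle : ∀ {G} → Cycle G → Cycle G → Set
SameCycle C D = ∀ e → (e ∈C C → e ∈C D) × (e ∈C D → e ∈C C)

AtLeastTwoCycles : Graph → Set
AtLeastTwoCycles G = Σ[ C ∈ Cycle G ] Σ[ D ∈ Cycle G ] ¬ SameCycle C D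

sumℕ : List ℕ → ℕ
sumℕ = foldr Data.Nat._+_ 0

sumℚ : List ℚ → ℚ
sumℚ = foldr Q._+_ 0ℚ

eqb : ∀ {k} → Fin k → Fin k → Bool
eqb a b = ⌊ a ≟ b ⌋

-- degree of vertex v in the spanning subgraph with edge set E (loops count 2)
deg : (G : Graph) → (Fin (m G) → Bool) → Fin (n G) → ℕ
deg G E v = sumℕ (Data.List.map f (allFin (m G)))
  where
  ind : Bool → ℕ
  ind true = 1
  ind false = 0
  f : Fin (m G) → ℕ
  f e = if E e then Data.Nat._+_ (ind (eqb (src G e) v)) (ind (eqb (tgt G e) v)) else 0

-- subgraph state: alive vertices and alive edges
State : Graph → Set
State G = (Fin (n G) → Bool) × (Fin (m G) → Bool)

data LeafDel (G : Graph) : State G → State G → Set where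
  del : ∀ (V : Fin (n G) → Bool) (E : Fin (m G) → Bool) (v : Fin (n G)) (e : Fin (m G)) →
        V v ≡ true → deg G E v ≡ 1 → E e ≡ true → (src G e ≡ v ⊎ tgt G e ≡ v) →
        LeafDel G (V , E) ((λ x → V x ∧ not (eqb x v)) , (λ x → E x ∧ not (eqb x e)))

NoLeaf : (G : Graph) → State G → Set
NoLeaf G (V , E) = ∀ v → V v ≡ true → ¬ (deg G E v ≡ 1)

IsTwoCore : (G : Graph) → State G → Set
IsTwoCore G S = Star (LeafDel G) ((λ _ → true) , (λ _ → true)) S × NoLeaf G S

-- directed edges: (e , true) goes src→tgt, (e , false) goes tgt→src
tail head : (G : Graph) → Fin (m G) → Bool → Fin (n G)
tail G e true = src G e
tail G e false = tgt G e
head G e true = tgt G e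
head G e false = src G e

beq : Bool → Bool → Bool
beq true b = b
beq false b = not b

-- sum of Γ over the non-backtracking successors of the directed edge (e , b)
-- inside the edge set E: directed edges (e' , b') of E whose tail is the head
-- of (e , b), other than the reversal (e , not b).
succSum : (G : Graph) → (Fin (m G) → Bool) → (Fin (m G) → Bool → ℚ) →
          Fin (m G) → Bool → ℚ
succSum G E Γ e b = sumℚ (concatMap (λ e' → g e' true ∷ g e' false ∷ []) (allFin (m G)))
  where
  g : Fin (m G) → Bool → ℚ
  g e' b' = if E e' ∧ eqb (tail G e' b') (head G e b) ∧ not (eqb e' e ∧ beq b' (not b))
            then Γ e' b' else 0ℚ

2ℚ : ℚ
2ℚ = 1ℚ Q.+ 1ℚ

module Submission where

-- Let d(x) be the number of non-backtracking steps from the arc x until the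
-- head of the current arc has degree at least three, and put Γ(x) = 1 + 2^-(d(x)+1).
-- If the head of x has degree ≥ 3, then x has two successors, each of weight ≥ 1,
-- so their sum is ≥ 2 > Γ(x).  Otherwise (degree 2, as the 2-core has no leaves) x
-- has a unique successor y, and d(x) = d(y) + 1 gives Γ(x) < Γ(y).  That d is finite
-- is the heart of the matter: a non-backtracking walk seeing only degree-2 heads for
-- more steps than there are arcs repeats an arc, hence runs around a closed walk; this
-- closed walk covers the connected 2-core and its edges are exactly the edges of every
-- cycle there, contradicting the existence of two different cycles.

open import Defs
open import Relation.Binary.Construct.Closure.ReflexiveTransitive as Closure using (Star; ε; _◅_)
open import Function using (_∘_; id)

preserved-along : ∀ {A : Set} {T : A → A → Set} (P : A → Set) →
                  (∀ {x y} → T x y → P x → P y) → ∀ {x y} → Star T x y → P x → P y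
preserved-along P preserve = Closure.fold (λ x y → P x → P y) (λ t rest → rest ∘ preserve t) id

module Counting where

  open import Data.Nat using (ℕ; zero; suc; _+_; _≤_; z≤n; s≤s; s≤s⁻¹)
  open import Data.Nat.Properties using (+-0-commutativeMonoid; +-suc; ≤-trans)
  open import Data.Fin as Fin using (Fin; zero; suc; punchIn)
  open import Data.Fin.Properties using (punchInᵢ≢i; any?)
  open import Data.Bool as Bool using (Bool; true; false; not; _∧_)
  open import Data.Bool.Properties using (¬-not; ∧-zeroʳ; ∧-identityʳ)
  open import Data.List using (map; allFin; tabulate)
  open import Data.List.Properties using (map-tabulate)
  open import Data.Product using (Σ-syntax; ∃-syntax; _×_; _,_; proj₁; proj₂)
  open import Data.Product.Properties using (≡-dec)
  open import Data.Sum using (inj₁; inj₂)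
  open import Relation.Nullary using (Dec; yes; no; contradiction)
  open import Relation.Nullary.Decidable using (map′; _⊎-dec_)
  open import Relation.Binary.Definitions using (DecidableEquality)
  open import Relation.Binary.PropositionalEquality
  open import Algebra.Properties.CommutativeMonoid.Sum +-0-commutativeMonoid
    using (sum; sum-remove; sum-cong-≗; sum-replicate-zero)
  open ≡-Reasoning

  eqb-refl : ∀ {k} (a : Fin k) → eqb a a ≡ true
  eqb-refl a with a Fin.≟ a
  ... | yes _ = refl
  ... | no a≢a = contradiction refl a≢a

  eqb-false : ∀ {k} {a b : Fin k} → a ≢ b → eqb a b ≡ false
  eqb-false {a = a} {b} a≢b with a Fin.≟ b
  ... | yes a≡b = contradiction a≡b a≢b
  ... | no _ = refl

  eqb-sound : ∀ {k} {a b : Fin k} → eqb a b ≡ true → a ≡ b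
  eqb-sound {a = a} {b} h with a Fin.≟ b
  ... | yes a≡b = a≡b
  eqb-sound () | no _

  beq-refl : ∀ b → beq b b ≡ true
  beq-refl true = refl
  beq-refl false = refl

  beq-false : ∀ {b c} → b ≢ c → beq b c ≡ false
  beq-false {true} {true} b≢c = contradiction refl b≢c
  beq-false {true} {false} _ = refl
  beq-false {false} {true} _ = refl
  beq-false {false} {false} b≢c = contradiction refl b≢c

  Dir : ℕ → Set
  Dir k = Fin k × Bool

  _≟ᵈ_ : ∀ {k} → DecidableEquality (Dir k)
  _≟ᵈ_ = ≡-dec Fin._≟_ Bool._≟_

  eqD : ∀ {k} → Dir k → Dir k → Bool
  eqD z w = eqb (proj₁ z) (proj₁ w) ∧ beq (proj₂ z) (proj₂ w)

  eqD-refl : ∀ {k} (z : Dir k) → eqD z z ≡ true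
  eqD-refl (e , b) rewrite eqb-refl e = beq-refl b

  eqD-false : ∀ {k} {z w : Dir k} → z ≢ w → eqD z w ≡ false
  eqD-false {z = e , b} {e' , b'} z≢w with e Fin.≟ e'
  ... | no _ = refl
  ... | yes refl = beq-false (z≢w ∘ cong (e ,_))

  _∖_ : ∀ {k} → (Dir k → Bool) → Dir k → (Dir k → Bool)
  (p ∖ z) w = p w ∧ not (eqD w z)

  ∖-self : ∀ {k} (p : Dir k → Bool) z → (p ∖ z) z ≡ false
  ∖-self p z rewrite eqD-refl z = ∧-zeroʳ (p z)

  ∖-other : ∀ {k} (p : Dir k → Bool) {z w} → w ≢ z → (p ∖ z) w ≡ p w
  ∖-other p {z} {w} w≢z rewrite eqD-false w≢z = ∧-identityʳ (p w)

  ∖-sound : ∀ {k} (p : Dir k → Bool) {z w} → (p ∖ z) w ≡ true → p w ≡ true × w ≢ z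
  ∖-sound p {z} {w} h with w ≟ᵈ z
  ... | yes refl = contradiction (trans (sym h) (∖-self p z)) λ ()
  ... | no w≢z = trans (sym (∖-other p w≢z)) h , w≢z

  indicator : Bool → ℕ
  indicator true = 1
  indicator false = 0

  pairCount : ∀ {k} → (Dir k → Bool) → Fin k → ℕ
  pairCount p e = indicator (p (e , true)) + indicator (p (e , false))

  count : ∀ {k} → (Dir k → Bool) → ℕ
  count p = sum (pairCount p)

  count-cong : ∀ {k} {p q : Dir k → Bool} → (∀ z → p z ≡ q z) → count p ≡ count q
  count-cong p≗q = sum-cong-≗ λ e → cong₂ _+_ (cong indicator (p≗q (e , true)))
                                             (cong indicator (p≗q (e , false)))

  count-from-summands : ∀ {k} (f : Fin k → ℕ) (p : Dir k → Bool) → (∀ e → f e ≡ pairCount p e) →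
                        sumℕ (map f (allFin k)) ≡ count p
  count-from-summands {k} f p f≗ = begin
    sumℕ (map f (allFin k))   ≡⟨ cong sumℕ (map-tabulate (λ i → i) f) ⟩
    sumℕ (tabulate f)         ≡⟨ sumℕ-tabulate f ⟩
    sum f                     ≡⟨ sum-cong-≗ f≗ ⟩
    count p                   ∎
    where
    sumℕ-tabulate : ∀ {k} (g : Fin k → ℕ) → sumℕ (tabulate g) ≡ sum g
    sumℕ-tabulate {zero} g = refl
    sumℕ-tabulate {suc k} g = cong (g zero +_) (sumℕ-tabulate (g ∘ suc))

  pairCount-removed : ∀ {k} (p : Dir k → Bool) {i b} → p (i , b) ≡ true →
                      pairCount p i ≡ suc (pairCount (p ∖ (i , b)) i)
  pairCount-removed p {i} {true} pz = begin
    indicator (p (i , true)) + indicator (p (i , false))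
      ≡⟨ cong (λ x → indicator x + indicator (p (i , false))) pz ⟩
    suc (indicator (p (i , false)))
      ≡⟨ cong suc (cong₂ (λ x y → indicator x + indicator y) (∖-self p (i , true)) (∖-other p (λ ()))) ⟨
    suc (pairCount (p ∖ (i , true)) i) ∎
  pairCount-removed p {i} {false} pz = begin
    indicator (p (i , true)) + indicator (p (i , false))
      ≡⟨ cong (λ x → indicator (p (i , true)) + indicator x) pz ⟩
    indicator (p (i , true)) + 1
      ≡⟨ +-suc (indicator (p (i , true))) 0 ⟩
    suc (indicator (p (i , true)) + 0)
      ≡⟨ cong suc (cong₂ (λ x y → indicator x + indicator y) (∖-other p (λ ())) (∖-self p (i , false))) ⟨
    suc (pairCount (p ∖ (i , false)) i) ∎

  pairCount-unaffected : ∀ {k} (p : Dir k → Bool) {i b j} → j ≢ i →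
                         pairCount p j ≡ pairCount (p ∖ (i , b)) j
  pairCount-unaffected p j≢i =
    sym (cong₂ _+_ (cong indicator (∖-other p (j≢i ∘ cong proj₁)))
                   (cong indicator (∖-other p (j≢i ∘ cong proj₁))))

  count-remove : ∀ {k} (p : Dir k → Bool) {z} → p z ≡ true → count p ≡ suc (count (p ∖ z))
  count-remove {suc k} p {i , b} pz = begin
    sum (pairCount p)
      ≡⟨ sum-remove (pairCount p) ⟩
    pairCount p i + sum (pairCount p ∘ punchIn i)
      ≡⟨ cong₂ _+_ (pairCount-removed p pz)
                   (sum-cong-≗ (λ j → pairCount-unaffected p (punchInᵢ≢i i j))) ⟩
    suc (pairCount q i + sum (pairCount q ∘ punchIn i))
      ≡⟨ cong suc (sum-remove (pairCount q)) ⟨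
    suc (count q) ∎
    where q = p ∖ (i , b)

  find : ∀ {k} (p : Dir k → Bool) → Dec (∃[ z ] p z ≡ true)
  find p = map′ to from (any? λ e → (p (e , true) Bool.≟ true) ⊎-dec (p (e , false) Bool.≟ true))
    where
    to : _
    to (e , inj₁ h) = (e , true) , h
    to (e , inj₂ h) = (e , false) , h
    from : _
    from ((e , true) , h) = e , inj₁ h
    from ((e , false) , h) = e , inj₂ h

  count-zero : ∀ {k} (p : Dir k → Bool) → (∀ z → p z ≡ false) → count p ≡ 0
  count-zero {k} p none =
    trans (sum-cong-≗ {k} {pairCount p} {λ _ → 0}
                       λ e → cong₂ _+_ (cong indicator (none (e , true))) (cong indicator (none (e , false))))
          (sum-replicate-zero k)

  witness : ∀ {k} (p : Dir k → Bool) → 1 ≤ count p → ∃[ z ] p z ≡ true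
  witness p pos with find p
  ... | yes w = w
  ... | no ¬w = contradiction (subst (1 ≤_) (count-zero p λ z → ¬-not λ pz → ¬w (z , pz)) pos) λ ()

  two-witnesses : ∀ {k} (p : Dir k → Bool) → 2 ≤ count p →
                  Σ[ a ∈ Dir k ] Σ[ b ∈ Dir k ] (a ≢ b × p a ≡ true × p b ≡ true)
  two-witnesses p two with witness p (≤-trans (s≤s z≤n) two)
  ... | a , pa with witness (p ∖ a) (s≤s⁻¹ (subst (2 ≤_) (count-remove p pa) two))
  ...   | b , qb with ∖-sound p qb
  ...     | pb , b≢a = a , b , b≢a ∘ sym , pa , pb

  unique-witness : ∀ {k} (p : Dir k → Bool) {a b} → count p ≤ 1 →
                   p a ≡ true → p b ≡ true → a ≡ b
  unique-witness p {a} {b} atMostOne pa pb with b ≟ᵈ a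
  ... | yes b≡a = sym b≡a
  ... | no b≢a = contradiction (≤-trans atLeastTwo atMostOne) λ { (s≤s ()) }
    where
    atLeastTwo : 2 ≤ count p
    atLeastTwo = subst (2 ≤_) (sym (trans (count-remove p pa)
                                         (cong suc (count-remove (p ∖ a) (trans (∖-other p b≢a) pb)))))
                      (s≤s (s≤s z≤n))

module RationalSums where

  open import Data.Bool using (Bool; true; false)
  open import Data.List using (List; []; _∷_; concatMap)
  open import Data.List.Membership.Propositional using (_∈_)
  open import Data.List.Relation.Unary.Any using (here; there)
  open import Data.Nat using (ℕ; zero; suc)
  open import Data.Product using (_,_)
  open import Data.Rational using (ℚ; 0ℚ; 1ℚ; ½; _+_; _*_; _≤_; _<_; _<?_; positive)
  open import Data.Rational.Properties
    using (≤-refl; ≤-reflexive; ≤-trans; <-trans; +-assoc; +-comm; +-identityʳ; +-mono-≤; +-monoʳ-≤;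
           *-zeroˡ; *-identityˡ; *-monoˡ-<-pos)
  open import Relation.Nullary using (contradiction)
  open import Relation.Nullary.Decidable using (toWitness)
  open import Relation.Binary.PropositionalEquality using (_≡_; _≢_; refl; sym; cong; subst)

  x≤x+y : ∀ {x y} → 0ℚ ≤ y → x ≤ x + y
  x≤x+y {x} {y} 0≤y = subst (_≤ x + y) (+-identityʳ x) (+-monoʳ-≤ x 0≤y)

  x≤y+x : ∀ {x y} → 0ℚ ≤ y → x ≤ y + x
  x≤y+x {x} {y} 0≤y = subst (x ≤_) (+-comm x y) (x≤x+y 0≤y)

  +-nonneg : ∀ {x y} → 0ℚ ≤ x → 0ℚ ≤ y → 0ℚ ≤ x + y
  +-nonneg 0≤x 0≤y = ≤-trans 0≤x (x≤x+y 0≤y)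

  -- The sum of the values g a true and g a false over all a in a list; this is
  -- the shape of Defs.succSum.
  pairSum : ∀ {A : Set} → (A → Bool → ℚ) → List A → ℚ
  pairSum g L = sumℚ (concatMap (λ a → g a true ∷ g a false ∷ []) L)

  module _ {A : Set} (g : A → Bool → ℚ) (g≥0 : ∀ a b → 0ℚ ≤ g a b) where

    pairSum-cons : ∀ a L → pairSum g (a ∷ L) ≡ (g a true + g a false) + pairSum g L
    pairSum-cons a L = sym (+-assoc (g a true) (g a false) (pairSum g L))

    pairSum-nonneg : ∀ L → 0ℚ ≤ pairSum g L
    pairSum-nonneg [] = ≤-refl
    pairSum-nonneg (a ∷ L) = +-nonneg (g≥0 a true) (+-nonneg (g≥0 a false) (pairSum-nonneg L))

    one≤pair : ∀ a b → g a b ≤ g a true + g a false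
    one≤pair a true = x≤x+y (g≥0 a false)
    one≤pair a false = x≤y+x (g≥0 a true)

    both≤pair : ∀ a {b c} → b ≢ c → g a b + g a c ≤ g a true + g a false
    both≤pair a {true} {false} _ = ≤-refl
    both≤pair a {false} {true} _ = ≤-reflexive (+-comm (g a false) (g a true))
    both≤pair a {true} {true} b≢c = contradiction refl b≢c
    both≤pair a {false} {false} b≢c = contradiction refl b≢c

    term≤pairSum : ∀ {a} b {L} → a ∈ L → g a b ≤ pairSum g L
    term≤pairSum b {a ∷ L} (here refl) rewrite pairSum-cons a L =
      ≤-trans (one≤pair a b) (x≤x+y (pairSum-nonneg L))
    term≤pairSum b {a ∷ L} (there a∈L) rewrite pairSum-cons a L =
      ≤-trans (term≤pairSum b a∈L) (x≤y+x (+-nonneg (g≥0 a true) (g≥0 a false)))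

    twoTerms≤pairSum : ∀ {a a'} b b' {L} → (a , b) ≢ (a' , b') → a ∈ L → a' ∈ L →
                       g a b + g a' b' ≤ pairSum g L
    twoTerms≤pairSum b b' {a ∷ L} distinct (here refl) (here refl) rewrite pairSum-cons a L =
      ≤-trans (both≤pair a (λ b≡b' → distinct (cong (a ,_) b≡b'))) (x≤x+y (pairSum-nonneg L))
    twoTerms≤pairSum b b' {a ∷ L} distinct (here refl) (there a'∈L) rewrite pairSum-cons a L =
      +-mono-≤ (one≤pair a b) (term≤pairSum b' a'∈L)
    twoTerms≤pairSum b b' {a ∷ L} distinct (there a∈L) (here refl) rewrite pairSum-cons a L =
      ≤-trans (≤-reflexive (+-comm (g _ b) (g a b')))
              (+-mono-≤ (one≤pair a b') (term≤pairSum b a∈L))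
    twoTerms≤pairSum b b' {a ∷ L} distinct (there a∈L) (there a'∈L) rewrite pairSum-cons a L =
      ≤-trans (twoTerms≤pairSum b b' distinct a∈L a'∈L) (x≤y+x (+-nonneg (g≥0 a true) (g≥0 a false)))

  halves : ℕ → ℚ
  halves zero = ½
  halves (suc k) = ½ * halves k

  0<½ : 0ℚ < ½
  0<½ = toWitness {a? = 0ℚ <? ½} _

  ½<1 : ½ < 1ℚ
  ½<1 = toWitness {a? = ½ <? 1ℚ} _

  halves-pos : ∀ k → 0ℚ < halves k
  halves-pos zero = 0<½
  halves-pos (suc k) = subst (_< ½ * halves k) (*-zeroˡ (halves k))
                         (*-monoˡ-<-pos (halves k) {{positive (halves-pos k)}} 0<½)

  halves-decreasing : ∀ k → halves (suc k) < halves k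
  halves-decreasing k = subst (½ * halves k <_) (*-identityˡ (halves k))
                          (*-monoˡ-<-pos (halves k) {{positive (halves-pos k)}} ½<1)

  halves<1 : ∀ k → halves k < 1ℚ
  halves<1 zero = ½<1
  halves<1 (suc k) = <-trans (halves-decreasing k) (halves<1 k)

module Cyclic where

  open import Data.Nat using (suc; s≤s; _<_; _<?_)
  open import Data.Nat.Properties using (<-irrefl)
  open import Data.Fin using (Fin; zero; suc; toℕ; fromℕ; inject₁)
  open import Data.Fin.Properties using (toℕ-fromℕ; toℕ-fromℕ<; toℕ-inject₁; toℕ-injective; toℕ<n)
  open import Data.Product using (∃-syntax; _,_)
  open import Relation.Nullary using (yes; no; contradiction)
  open import Relation.Binary.PropositionalEquality

  next-surjective : ∀ {k} (s : Fin (suc k)) → ∃[ s' ] next s' ≡ s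
  next-surjective {k} zero = fromℕ k , last↦zero
    where
    last↦zero : next (fromℕ k) ≡ zero
    last↦zero with suc (toℕ (fromℕ k)) <? suc k
    ... | yes k<k = contradiction (subst (λ i → suc i < suc k) (toℕ-fromℕ k) k<k) (<-irrefl refl)
    ... | no _ = refl
  next-surjective {k} (suc j) = inject₁ j , inject₁↦suc
    where
    inject₁↦suc : next (inject₁ j) ≡ suc j
    inject₁↦suc with suc (toℕ (inject₁ j)) <? suc k
    ... | yes j<k = toℕ-injective (trans (toℕ-fromℕ< j<k) (cong suc (toℕ-inject₁ j)))
    ... | no j≮k = contradiction (s≤s (subst (_< k) (sym (toℕ-inject₁ j)) (toℕ<n j))) j≮k

module Arcs (G : Graph) where

  open Counting
  open import Data.Nat using (ℕ; suc)
  open import Data.Fin using (Fin)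
  open import Data.Bool using (Bool; true; false; not; _∧_)
  open import Data.Bool.Properties using (∧-assoc; not-involutive; not-¬)
  open import Data.List using (map; allFin)
  open import Data.Product using (Σ-syntax; _×_; _,_; proj₁; proj₂)
  open import Data.Sum using (_⊎_; inj₁; inj₂)
  open import Relation.Nullary using (contradiction)
  open import Relation.Binary.PropositionalEquality
  open ≡-Reasoning

  Vertex : Set
  Vertex = Fin (n G)

  Arc : Set
  Arc = Dir (m G)

  tl hd : Arc → Vertex
  tl (e , b) = tail G e b
  hd (e , b) = head G e b

  rev : Arc → Arc
  rev z = proj₁ z , not (proj₂ z)

  tl-rev : ∀ z → tl (rev z) ≡ hd z
  tl-rev (e , true) = refl
  tl-rev (e , false) = refl

  hd-rev : ∀ z → hd (rev z) ≡ tl z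
  hd-rev (e , true) = refl
  hd-rev (e , false) = refl

  rev-involutive : ∀ z → rev (rev z) ≡ z
  rev-involutive (e , b) = cong (e ,_) (not-involutive b)

  rev-≢ : ∀ z → rev z ≢ z
  rev-≢ (e , b) rz≡z = not-¬ refl (sym (cong proj₂ rz≡z))

  turn-back : ∀ z z' → proj₁ z ≡ proj₁ z' → tl z ≢ tl z' → hd z' ≡ tl z
  turn-back (e , true) (.e , true) refl tz≢tz' = contradiction refl tz≢tz'
  turn-back (e , true) (.e , false) refl _ = refl
  turn-back (e , false) (.e , true) refl _ = refl
  turn-back (e , false) (.e , false) refl tz≢tz' = contradiction refl tz≢tz'

  arcOf : ∀ {e u w} → Joins G e u w → Arc
  arcOf {e} (inj₁ _) = e , true
  arcOf {e} (inj₂ _) = e , false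

  arcOf-edge : ∀ {e u w} (j : Joins G e u w) → proj₁ (arcOf j) ≡ e
  arcOf-edge (inj₁ _) = refl
  arcOf-edge (inj₂ _) = refl

  arcOf-tl : ∀ {e u w} (j : Joins G e u w) → tl (arcOf j) ≡ u
  arcOf-tl (inj₁ (su , _)) = su
  arcOf-tl (inj₂ (_ , tu)) = tu

  arcOf-hd : ∀ {e u w} (j : Joins G e u w) → hd (arcOf j) ≡ w
  arcOf-hd (inj₁ (_ , tw)) = tw
  arcOf-hd (inj₂ (sw , _)) = sw

  leaving-arc : ∀ {e v} → (src G e ≡ v) ⊎ (tgt G e ≡ v) → Σ[ z ∈ Arc ] proj₁ z ≡ e × tl z ≡ v
  leaving-arc {e} (inj₁ src≡v) = (e , true) , refl , src≡v
  leaving-arc {e} (inj₂ tgt≡v) = (e , false) , refl , tgt≡v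

  EdgeSet : Set
  EdgeSet = Fin (m G) → Bool

  Alive : EdgeSet → Arc → Set
  Alive E z = E (proj₁ z) ≡ true

  Step : EdgeSet → Vertex → Vertex → Set
  Step E u w = Σ[ z ∈ Arc ] Alive E z × tl z ≡ u × hd z ≡ w

  out : EdgeSet → Vertex → Arc → Bool
  out E w z = E (proj₁ z) ∧ eqb (tl z) w

  out-intro : ∀ {E w z} → Alive E z → tl z ≡ w → out E w z ≡ true
  out-intro {z = z} az refl rewrite az = eqb-refl (tl z)

  out-sound : ∀ {E w z} → out E w z ≡ true → Alive E z × tl z ≡ w
  out-sound {E} {z = z} h with E (proj₁ z)
  ... | true = refl , eqb-sound h

  -- The non-backtracking successors of x in E, written exactly as in Defs.succSum:
  -- arcs of E leaving the head of x, other than the reverse of x.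
  succ : EdgeSet → Arc → Arc → Bool
  succ E (e , b) (e' , b') =
    E e' ∧ eqb (tail G e' b') (head G e b) ∧ not (eqb e' e ∧ beq b' (not b))

  succ-is-out : ∀ E x z → succ E x z ≡ (out E (hd x) ∖ rev x) z
  succ-is-out E (e , b) (e' , b') = sym (∧-assoc (E e') _ _)

  succ-intro : ∀ {E x z} → Alive E z → tl z ≡ hd x → z ≢ rev x → succ E x z ≡ true
  succ-intro {E} {x} {z} az tz z≢rx =
    trans (succ-is-out E x z) (trans (∖-other (out E (hd x)) z≢rx) (out-intro {E} {hd x} {z} az tz))

  succ-sound : ∀ {E x z} → succ E x z ≡ true → Alive E z × tl z ≡ hd x
  succ-sound {E} {x} {z} h =
    out-sound {E} {hd x} {z} (proj₁ (∖-sound (out E (hd x)) {rev x} {z} (trans (sym (succ-is-out E x z)) h)))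

  -- Defs.deg sums a summand that is local to Defs; it is recovered here by unification.
  summandOf : ∀ {k} (s : ℕ) {f : Fin k → ℕ} → s ≡ sumℕ (map f (allFin k)) → Fin k → ℕ
  summandOf _ {f} _ = f

  degSummand : EdgeSet → Vertex → Fin (m G) → ℕ
  degSummand E w = summandOf (deg G E w) refl

  degSummand-count : ∀ E w e → degSummand E w e ≡ pairCount (out E w) e
  degSummand-count E w e with E e | eqb (src G e) w | eqb (tgt G e) w
  ... | false | _ | _ = refl
  ... | true | true | true = refl
  ... | true | true | false = refl
  ... | true | false | true = refl
  ... | true | false | false = refl

  -- The degree of w counts the arcs of E leaving w (a loop yields two of them).
  deg-count : ∀ E w → deg G E w ≡ count (out E w)
  deg-count E w = count-from-summands (degSummand E w) (out E w) (degSummand-count E w)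

  -- The arcs leaving the head of an alive arc x are its reverse and its successors.
  deg-succ : ∀ E x → Alive E x → deg G E (hd x) ≡ suc (count (succ E x))
  deg-succ E x ax = begin
    deg G E (hd x)                          ≡⟨ deg-count E (hd x) ⟩
    count (out E (hd x))                    ≡⟨ count-remove (out E (hd x)) reverse-leaves ⟩
    suc (count (out E (hd x) ∖ rev x))      ≡⟨ cong suc (count-cong (λ z → sym (succ-is-out E x z))) ⟩
    suc (count (succ E x))                  ∎
    where
    reverse-leaves : out E (hd x) (rev x) ≡ true
    reverse-leaves = out-intro {E} {hd x} {rev x} ax (tl-rev x)

  module CycleArcs (H : Cycle G) where
    open Cycle H

    cycleArc : Fin (suc k) → Arc
    cycleArc s = arcOf (joins s)

    cycleArc-edge : ∀ s → proj₁ (cycleArc s) ≡ es s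
    cycleArc-edge s = arcOf-edge (joins s)

    cycleArc-tl : ∀ s → tl (cycleArc s) ≡ vs s
    cycleArc-tl s = arcOf-tl (joins s)

    cycleArc-hd : ∀ s → hd (cycleArc s) ≡ vs (next s)
    cycleArc-hd s = arcOf-hd (joins s)

    entering-rev-tl : ∀ {s s'} → next s' ≡ s → tl (rev (cycleArc s')) ≡ vs s
    entering-rev-tl {s} {s'} s'↦s = begin
      tl (rev (cycleArc s'))  ≡⟨ tl-rev (cycleArc s') ⟩
      hd (cycleArc s')        ≡⟨ cycleArc-hd s' ⟩
      vs (next s')            ≡⟨ cong vs s'↦s ⟩
      vs s                    ∎

    -- No arc of the cycle is the reverse of another, since its edges are distinct; so at
    -- each vertex of the cycle the leaving arc and the reversed entering arc differ.
    cycleArc≢rev : ∀ s s' → cycleArc s ≢ rev (cycleArc s')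
    cycleArc≢rev s s' eq with es-inj (trans (sym (cycleArc-edge s)) (trans (cong proj₁ eq) (cycleArc-edge s')))
    ... | refl = rev-≢ (cycleArc s) (sym eq)

module LeafDeletion (G : Graph) where

  open Counting
  open Arcs G
  open Cyclic using (next-surjective)
  open import Data.Nat.Properties using (≤-reflexive)
  open import Data.Fin as Fin using (Fin)
  open import Data.Bool using (Bool; true; not; _∧_)
  open import Data.Product using (_×_; _,_; proj₁; proj₂)
  open import Data.Sum using (_⊎_)
  open import Relation.Nullary using (yes; no; contradiction)
  open import Relation.Binary.PropositionalEquality
  open ≡-Reasoning

  record Healthy (S : State G) : Set where
    field
      tail-alive : ∀ z → Alive (proj₂ S) z → proj₁ S (tl z) ≡ true
      connected : ∀ {a b} → proj₁ S a ≡ true → proj₁ S b ≡ true → Star (Step (proj₂ S)) a b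

  CycleAlive : Cycle G → EdgeSet → Set
  CycleAlive H E = ∀ s → E (Cycle.es H s) ≡ true

  fullState : State G
  fullState = (λ _ → true) , (λ _ → true)

  full-healthy : Connected G → Healthy fullState
  full-healthy connected = record { tail-alive = λ _ _ → refl ; connected = λ {a} {b} _ _ → walk (connected a b) }
    where
    walk : ∀ {a b} → Reach G a b → Star (Step (λ _ → true)) a b
    walk here = ε
    walk (step e j r) = (arcOf j , refl , arcOf-tl j , arcOf-hd j) ◅ walk r

  keep : ∀ {k} {a : Bool} {x y : Fin k} → a ≡ true → x ≢ y → a ∧ not (eqb x y) ≡ true
  keep refl x≢y rewrite eqb-false x≢y = refl

  kept : ∀ {k} {a : Bool} {x y : Fin k} → a ∧ not (eqb x y) ≡ true → a ≡ true × x ≢ y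
  kept {a = true} {x} h = refl , λ { refl → contradiction (trans (sym h) (cong not (eqb-refl x))) λ () }

  module Deletion (V : Vertex → Bool) (E : EdgeSet) (v : Vertex) (e0 : Fin (m G))
                  (deg1 : deg G E v ≡ 1) (alive-e0 : E e0 ≡ true)
                  (incident : (src G e0 ≡ v) ⊎ (tgt G e0 ≡ v)) where

    V' : Vertex → Bool
    V' x = V x ∧ not (eqb x v)

    E' : EdgeSet
    E' x = E x ∧ not (eqb x e0)

    leafArc : Arc
    leafArc = proj₁ (leaving-arc incident)

    leafArc-edge : proj₁ leafArc ≡ e0
    leafArc-edge = proj₁ (proj₂ (leaving-arc incident))

    leafArc-tl : tl leafArc ≡ v
    leafArc-tl = proj₂ (proj₂ (leaving-arc incident))

    leafArc-unique : ∀ z → Alive E z → tl z ≡ v → z ≡ leafArc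
    leafArc-unique z az tz =
      unique-witness (out E v) (≤-reflexive (trans (sym (deg-count E v)) deg1))
        (out-intro {E} {v} {z} az tz)
        (out-intro {E} {v} {leafArc} (trans (cong E leafArc-edge) alive-e0) leafArc-tl)

    away-from-leaf : ∀ z → Alive E z → proj₁ z ≢ e0 → tl z ≢ v
    away-from-leaf z az z≢e0 tz = z≢e0 (trans (cong proj₁ (leafArc-unique z az tz)) leafArc-edge)

    into-leaf : ∀ z → proj₁ z ≡ e0 → tl z ≢ v → hd z ≡ v
    into-leaf z z≡e0 tz≢v =
      trans (turn-back leafArc z (trans leafArc-edge (sym z≡e0)) (λ same → tz≢v (trans (sym same) leafArc-tl)))
            leafArc-tl

    tail-alive' : (∀ z → Alive E z → V (tl z) ≡ true) → ∀ z → Alive E' z → V' (tl z) ≡ true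
    tail-alive' tail-alive z az' with kept {a = E (proj₁ z)} az'
    ... | az , z≢e0 = keep (tail-alive z az) (away-from-leaf z az z≢e0)

    -- A walk between vertices other than v that passes through v enters it along e0
    -- and must leave it along e0 again, back to where it came from; skip that detour.
    shortcut : ∀ {a b} → Star (Step E) a b → a ≢ v → b ≢ v → Star (Step E') a b
    shortcut ε _ _ = ε
    shortcut {a} ((z , az , tz , hz) ◅ r) a≢v b≢v with proj₁ z Fin.≟ e0
    ... | no z≢e0 = (z , keep az z≢e0 , tz , hz) ◅ shortcut r w≢v b≢v
      where
      w≢v : _ ≢ v
      w≢v w≡v = away-from-leaf (rev z) az z≢e0 (trans (tl-rev z) (trans hz w≡v))
    ... | yes z≡e0 with into-leaf z z≡e0 (a≢v ∘ trans (sym tz))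
    ...   | hz≡v with r
    ...     | ε = contradiction (trans (sym hz) hz≡v) b≢v
    ...     | (z' , az' , tz' , hz') ◅ r' =
      subst (λ c → Star (Step E') c _) w'≡a (shortcut r' (a≢v ∘ trans (sym w'≡a)) b≢v)
      where
      z'-leaves-v : tl z' ≡ v
      z'-leaves-v = trans tz' (trans (sym hz) hz≡v)
      w'≡a : _ ≡ a
      w'≡a = begin
        _      ≡⟨ sym hz' ⟩
        hd z'  ≡⟨ turn-back z z' (trans z≡e0 (sym (trans (cong proj₁ (leafArc-unique z' az' z'-leaves-v)) leafArc-edge)))
                            (λ same → a≢v (trans (sym tz) (trans same z'-leaves-v))) ⟩
        tl z   ≡⟨ tz ⟩
        a      ∎

    connected' : (∀ {a b} → V a ≡ true → V b ≡ true → Star (Step E) a b) →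
                 ∀ {a b} → V' a ≡ true → V' b ≡ true → Star (Step E') a b
    connected' connected a' b' with kept {a = V _} a' | kept {a = V _} b'
    ... | va , a≢v | vb , b≢v = shortcut (connected va vb) a≢v b≢v

    -- A cycle whose edges are alive avoids the leaf, so it survives the deletion.
    module _ (H : Cycle G) (alive : CycleAlive H E) where
      open Cycle H
      open CycleArcs H

      cycle-avoids-leaf : ∀ t → vs t ≢ v
      cycle-avoids-leaf t vt≡v with next-surjective t
      ... | t' , t'↦t = cycleArc≢rev t t' (trans (leafArc-unique (cycleArc t) leaving-alive leaving-tl)
                                                     (sym (leafArc-unique (rev (cycleArc t')) entering-alive entering-tl)))
        where
        leaving-alive : Alive E (cycleArc t)
        leaving-alive = trans (cong E (cycleArc-edge t)) (alive t)
        leaving-tl : tl (cycleArc t) ≡ v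
        leaving-tl = trans (cycleArc-tl t) vt≡v
        entering-alive : Alive E (rev (cycleArc t'))
        entering-alive = trans (cong E (cycleArc-edge t')) (alive t')
        entering-tl : tl (rev (cycleArc t')) ≡ v
        entering-tl = trans (entering-rev-tl t'↦t) vt≡v

      cycle-survives : CycleAlive H E'
      cycle-survives s = keep (alive s) es≢e0
        where
        es≢e0 : es s ≢ e0
        es≢e0 es≡e0 with tl (cycleArc s) Fin.≟ v
        ... | yes t≡v = cycle-avoids-leaf s (trans (sym (cycleArc-tl s)) t≡v)
        ... | no t≢v = cycle-avoids-leaf (next s)
                         (trans (sym (cycleArc-hd s)) (into-leaf (cycleArc s) (trans (cycleArc-edge s) es≡e0) t≢v))

  healthy-after : Connected G → ∀ {S} → Star (LeafDel G) fullState S → Healthy S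
  healthy-after connected deletions = preserved-along Healthy deletion-step deletions (full-healthy connected)
    where
    deletion-step : ∀ {S S'} → LeafDel G S S' → Healthy S → Healthy S'
    deletion-step (del V E v e _ deg1 alive-e incident) h = record
      { tail-alive = Deletion.tail-alive' V E v e deg1 alive-e incident (Healthy.tail-alive h)
      ; connected = Deletion.connected' V E v e deg1 alive-e incident (Healthy.connected h) }

  cycle-alive-after : ∀ H {S} → Star (LeafDel G) fullState S → CycleAlive H (proj₂ S)
  cycle-alive-after H deletions = preserved-along (CycleAlive H ∘ proj₂) deletion-step deletions (λ _ → refl)
    where
    deletion-step : ∀ {S S'} → LeafDel G S S' → CycleAlive H (proj₂ S) → CycleAlive H (proj₂ S')
    deletion-step (del V E v e _ deg1 alive-e incident) = Deletion.cycle-survives V E v e deg1 alive-e incident H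

module TwoCore (G : Graph) (S : State G) (healthy : LeafDeletion.Healthy G S) (no-leaf : NoLeaf G S) where

  open Counting
  open Arcs G
  open LeafDeletion G
  open Healthy healthy
  open Cyclic using (next-surjective)
  open import Data.Nat using (ℕ; zero; suc; _+_; _*_; _≤_; _<_; _≤?_; s≤s⁻¹; _%_; _/_)
  open import Data.Nat.Properties
    using (n≢0⇒n>0; ≰⇒>; n<1+n; +-suc; +-comm; +-assoc; *-suc; *-identityˡ; +-monoˡ-<; <-trans;
           m≤n⇒∃[o]m+o≡n; anyUpTo?)
  open import Data.Nat.DivMod using (m≡m%n+[m/n]*n; m%n<n)
  open import Data.Nat.GeneralisedArithmetic using (fold; fold-+)
  open import Data.Fin as Fin using (Fin; toℕ; join; splitAt)
  open import Data.Fin.Properties using (splitAt-join; pigeonhole; toℕ<n)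
  open import Data.Bool using (Bool; true; false)
  open import Data.Product using (Σ-syntax; ∃-syntax; _×_; _,_; proj₁; proj₂)
  open import Data.Sum using (_⊎_; inj₁; inj₂)
  open import Data.Sum.Properties using (inj₁-injective; inj₂-injective)
  open import Relation.Nullary using (¬_; Dec; yes; no; contradiction)
  open import Relation.Binary.PropositionalEquality
  open ≡-Reasoning

  V : Vertex → Bool
  V = proj₁ S

  E : EdgeSet
  E = proj₂ S

  head-alive : ∀ x → Alive E x → V (hd x) ≡ true
  head-alive x ax = subst (λ w → V w ≡ true) (tl-rev x) (tail-alive (rev x) ax)

  -- Since no alive vertex is a leaf, every alive arc can be continued without backtracking.
  has-successor : ∀ x → Alive E x → 1 ≤ count (succ E x)
  has-successor x ax =
    n≢0⇒n>0 λ none → no-leaf (hd x) (head-alive x ax) (trans (deg-succ E x ax) (cong suc none))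

  -- A chosen non-backtracking successor of each arc.  It is opaque: everything else
  -- only uses nxt-succ, and unfolding the search would bloat every goal mentioning nxt.
  opaque
    nxt : Arc → Arc
    nxt x with find (succ E x)
    ... | yes (z , _) = z
    ... | no _ = x

    nxt-succ : ∀ x → Alive E x → succ E x (nxt x) ≡ true
    nxt-succ x ax with find (succ E x)
    ... | yes (_ , h) = h
    ... | no none = contradiction (witness (succ E x) (has-successor x ax)) none

  nxt-alive : ∀ x → Alive E x → Alive E (nxt x)
  nxt-alive x ax = proj₁ (succ-sound {E} {x} {nxt x} (nxt-succ x ax))

  nxt-tl : ∀ x → Alive E x → tl (nxt x) ≡ hd x
  nxt-tl x ax = proj₂ (succ-sound {E} {x} {nxt x} (nxt-succ x ax))

  Branching : Arc → Set
  Branching x = 3 ≤ deg G E (hd x)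

  branching? : ∀ x → Dec (Branching x)
  branching? x = 3 ≤? deg G E (hd x)

  successor-unique : ∀ x z → Alive E x → ¬ Branching x → succ E x z ≡ true → z ≡ nxt x
  successor-unique x z ax flat h = unique-witness (succ E x) atMostOne h (nxt-succ x ax)
    where
    atMostOne : count (succ E x) ≤ 1
    atMostOne = s≤s⁻¹ (subst (_≤ 2) (deg-succ E x ax) (s≤s⁻¹ (≰⇒> flat)))

  two-successors : ∀ x → Alive E x → Branching x →
                   Σ[ a ∈ Arc ] Σ[ c ∈ Arc ] (a ≢ c × succ E x a ≡ true × succ E x c ≡ true)
  two-successors x ax br = two-witnesses (succ E x) (s≤s⁻¹ (subst (3 ≤_) (deg-succ E x ax) br))

  walk : Arc → ℕ → Arc
  walk x t = fold x nxt t

  walk-alive : ∀ x → Alive E x → ∀ t → Alive E (walk x t)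
  walk-alive x ax zero = ax
  walk-alive x ax (suc t) = nxt-alive (walk x t) (walk-alive x ax t)

  walk-shift : ∀ x t → walk x (suc t) ≡ walk (nxt x) t
  walk-shift x t = trans (cong (walk x) (+-comm 1 t)) (fold-+ x nxt t)

  -- A closed walk without branching heads runs through every alive vertex, and the edge
  -- set of every alive cycle is exactly the set of edges it traverses.
  module Orbit (u : Arc) (alive-u : Alive E u) (p : ℕ) (closed : walk u (suc p) ≡ u)
               (flat : ∀ t → t < suc p → ¬ Branching (walk u t)) where

    W : ℕ → Arc
    W = walk u

    P : ℕ
    P = suc p

    W-alive : ∀ t → Alive E (W t)
    W-alive = walk-alive u alive-u

    W-repeats : ∀ c → W (c * P) ≡ u
    W-repeats zero = refl
    W-repeats (suc c) = begin
      W (P + c * P)          ≡⟨ fold-+ u nxt P ⟩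
      walk (W (c * P)) P     ≡⟨ cong (λ x → walk x P) (W-repeats c) ⟩
      W P                    ≡⟨ closed ⟩
      u                      ∎

    W-periodic : ∀ t c → W (t + c * P) ≡ W t
    W-periodic t c = trans (fold-+ u nxt t) (cong (λ x → walk x t) (W-repeats c))

    W-flat : ∀ t → ¬ Branching (W t)
    W-flat t = subst (¬_ ∘ Branching) W-mod (flat (t % P) (m%n<n t P))
      where
      W-mod : W (t % P) ≡ W t
      W-mod = sym (trans (cong W (m≡m%n+[m/n]*n t P)) (W-periodic (t % P) (t / P)))

    leaving-orbit : ∀ t z → Alive E z → tl z ≡ hd (W t) → (z ≡ W (suc t)) ⊎ (z ≡ rev (W t))
    leaving-orbit t z az tz with z ≟ᵈ rev (W t)
    ... | yes z≡r = inj₂ z≡r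
    ... | no z≢r = inj₁ (successor-unique (W t) z (W-alive t) (W-flat t) (succ-intro {E} {W t} {z} az tz z≢r))

    -- The vertices that are heads of the walk; every alive vertex is one, since they
    -- contain the tails of the walk, are closed under steps in E, and E is connected.
    OnOrbit : Vertex → Set
    OnOrbit w = Σ[ t ∈ ℕ ] hd (W t) ≡ w

    tail-on-orbit : ∀ t → OnOrbit (tl (W t))
    tail-on-orbit t = t + p , (begin
      hd (W (t + p))            ≡⟨ nxt-tl (W (t + p)) (W-alive (t + p)) ⟨
      tl (W (suc (t + p)))      ≡⟨ cong (tl ∘ W) (+-suc t p) ⟨
      tl (W (t + P))            ≡⟨ cong (tl ∘ W ∘ (t +_)) (*-identityˡ P) ⟨
      tl (W (t + 1 * P))        ≡⟨ cong tl (W-periodic t 1) ⟩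
      tl (W t)                  ∎)

    step-on-orbit : ∀ {a b} → Step E a b → OnOrbit a → OnOrbit b
    step-on-orbit (z , az , tz , hz) (t , ht) with leaving-orbit t z az (trans tz (sym ht))
    ... | inj₁ z≡next = suc t , trans (cong hd (sym z≡next)) hz
    ... | inj₂ z≡back with tail-on-orbit t
    ...   | t' , ht' = t' , trans ht' (trans (sym (hd-rev (W t))) (trans (cong hd (sym z≡back)) hz))

    orbit-covers : ∀ {w} → V w ≡ true → OnOrbit w
    orbit-covers vw = preserved-along OnOrbit step-on-orbit (connected (head-alive u alive-u) vw) (0 , refl)

    module OnCycle (H : Cycle G) (alive : CycleAlive H E) where
      open Cycle H
      open CycleArcs H

      cycleArc-alive : ∀ s → Alive E (cycleArc s)
      cycleArc-alive s = trans (cong E (cycleArc-edge s)) (alive s)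

      Meets : Fin (suc k) → ℕ → Set
      Meets s t = (W t ≡ cycleArc s) ⊎ (W t ≡ rev (cycleArc s))

      meets-edge : ∀ s t → Meets s t → proj₁ (W t) ≡ es s
      meets-edge s t (inj₁ eq) = trans (cong proj₁ eq) (cycleArc-edge s)
      meets-edge s t (inj₂ eq) = trans (cong proj₁ eq) (cycleArc-edge s)

      every-arc-met : ∀ s → Σ[ t ∈ ℕ ] Meets s t
      every-arc-met s with orbit-covers (tail-alive (cycleArc s) (cycleArc-alive s))
      ... | t , ht with leaving-orbit t (cycleArc s) (cycleArc-alive s) (sym ht)
      ...   | inj₁ c≡next = suc t , inj₁ (sym c≡next)
      ...   | inj₂ c≡back = t , inj₂ (trans (sym (rev-involutive (W t))) (cong rev (sym c≡back)))

      cycle⊆orbit : ∀ s → Σ[ t ∈ ℕ ] proj₁ (W t) ≡ es s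
      cycle⊆orbit s with every-arc-met s
      ... | t , meets = t , meets-edge s t meets

      -- Once on the cycle, the walk follows it: the successor along the cycle is the
      -- unique successor at a head of degree two.
      Aligned : ℕ → Set
      Aligned t = Σ[ s ∈ Fin (suc k) ] Meets s t

      aligned-step : ∀ t → Aligned t → Aligned (suc t)
      aligned-step t (s , inj₁ W≡c) = next s , inj₁ (sym (successor-unique (W t) (cycleArc (next s)) (W-alive t) (W-flat t) follows))
        where
        follows : succ E (W t) (cycleArc (next s)) ≡ true
        follows = succ-intro {E} {W t} {cycleArc (next s)} (cycleArc-alive (next s))
          (trans (cycleArc-tl (next s)) (sym (trans (cong hd W≡c) (cycleArc-hd s))))
          (λ eq → cycleArc≢rev (next s) s (trans eq (cong rev W≡c)))
      aligned-step t (s , inj₂ W≡r) with next-surjective s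
      ... | s' , s'↦s = s' , inj₂ (sym (successor-unique (W t) (rev (cycleArc s')) (W-alive t) (W-flat t) follows))
        where
        follows : succ E (W t) (rev (cycleArc s')) ≡ true
        follows = succ-intro {E} {W t} {rev (cycleArc s')} (cycleArc-alive s')
          (trans (entering-rev-tl s'↦s) (sym (trans (cong hd W≡r) (trans (hd-rev (cycleArc s)) (cycleArc-tl s)))))
          (λ eq → cycleArc≢rev s s' (sym (trans eq (trans (cong rev W≡r) (rev-involutive (cycleArc s))))))

      aligned-after : ∀ {t₀} → Aligned t₀ → ∀ j → Aligned (j + t₀)
      aligned-after a zero = a
      aligned-after {t₀} a (suc j) = aligned-step (j + t₀) (aligned-after a j)

      -- Every edge traversed by the walk lies on H: by periodicity, time t recurs after
      -- the walk has become aligned with H.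
      orbit⊆cycle : ∀ t → Σ[ s ∈ Fin (suc k) ] es s ≡ proj₁ (W t)
      orbit⊆cycle t with every-arc-met Fin.zero
      ... | t₀ , meets₀ with aligned-after (Fin.zero , meets₀) (t + t₀ * p)
      ...   | s , meets = s , sym (trans (cong proj₁ later≡now) (meets-edge s (t + t₀ * p + t₀) meets))
        where
        later≡now : W t ≡ W (t + t₀ * p + t₀)
        later≡now = begin
          W t                      ≡⟨ W-periodic t t₀ ⟨
          W (t + t₀ * P)           ≡⟨ cong (W ∘ (t +_)) (*-suc t₀ p) ⟩
          W (t + (t₀ + t₀ * p))    ≡⟨ cong (W ∘ (t +_)) (+-comm t₀ (t₀ * p)) ⟩
          W (t + (t₀ * p + t₀))    ≡⟨ cong W (+-assoc t (t₀ * p) t₀) ⟨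
          W (t + t₀ * p + t₀)      ∎

    same-cycle : ∀ C D → CycleAlive C E → CycleAlive D E → SameCycle C D
    same-cycle C D alive-C alive-D e = via C D alive-C alive-D , via D C alive-D alive-C
      where
      via : ∀ H H' → CycleAlive H E → CycleAlive H' E → e ∈C H → e ∈C H'
      via H H' alive-H alive-H' (s , es≡e) with OnCycle.cycle⊆orbit H alive-H s
      ... | t , q with OnCycle.orbit⊆cycle H' alive-H' t
      ...   | s' , q' = s' , trans q' (trans q es≡e)

  -- Arcs are coded injectively by Fin (m G + m G), for the pigeonhole principle.
  arcSide : Arc → Fin (m G) ⊎ Fin (m G)
  arcSide (e , true) = inj₁ e
  arcSide (e , false) = inj₂ e

  arcCode : Arc → Fin (m G + m G)
  arcCode = join (m G) (m G) ∘ arcSide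

  arcCode-injective : ∀ z z' → arcCode z ≡ arcCode z' → z ≡ z'
  arcCode-injective z z' eq =
    side-injective z z' (trans (sym (splitAt-join (m G) (m G) (arcSide z)))
                        (trans (cong (splitAt (m G)) eq) (splitAt-join (m G) (m G) (arcSide z'))))
    where
    side-injective : ∀ z z' → arcSide z ≡ arcSide z' → z ≡ z'
    side-injective (e , true) (e' , true) eq = cong (_, _) (inj₁-injective eq)
    side-injective (e , false) (e' , false) eq = cong (_, _) (inj₂-injective eq)
    side-injective (e , true) (e' , false) ()
    side-injective (e , false) (e' , true) ()

  horizon : ℕ
  horizon = suc (m G + m G)

  -- If E contains two different cycles, every walk branches within the horizon: otherwise
  -- an arc repeats (pigeonhole) and the closed walk between the repetitions is an Orbit.
  eventually-branching : ∀ C D → CycleAlive C E → CycleAlive D E → ¬ SameCycle C D →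
                         ∀ {y} → Alive E y → ∃[ t ] (t < horizon × Branching (walk y t))
  eventually-branching C D alive-C alive-D C≠D {y} ay with anyUpTo? (branching? ∘ walk y) horizon
  ... | yes found = found
  ... | no none with pigeonhole (n<1+n (m G + m G)) (arcCode ∘ walk y ∘ toℕ)
  ...   | i , j , i<j , codes≡ with m≤n⇒∃[o]m+o≡n i<j
  ...     | o , i+o≡j = contradiction (Orbit.same-cycle u (walk-alive y ay (toℕ i)) o closed flat C D alive-C alive-D) C≠D
    where
    u : Arc
    u = walk y (toℕ i)

    period≡j : suc o + toℕ i ≡ toℕ j
    period≡j = trans (cong suc (+-comm o (toℕ i))) i+o≡j

    closed : walk u (suc o) ≡ u
    closed = begin
      walk u (suc o)            ≡⟨ fold-+ y nxt (suc o) ⟨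
      walk y (suc o + toℕ i)    ≡⟨ cong (walk y) period≡j ⟩
      walk y (toℕ j)            ≡⟨ arcCode-injective _ _ codes≡ ⟨
      u                         ∎

    flat : ∀ t → t < suc o → ¬ Branching (walk u t)
    flat t t<period br = none (t + toℕ i , within , subst Branching (sym (fold-+ y nxt t)) br)
      where
      within : t + toℕ i < horizon
      within = <-trans (subst (t + toℕ i <_) period≡j (+-monoˡ-< (toℕ i) t<period)) (toℕ<n j)

  opaque
    dist : ℕ → Arc → ℕ
    dist zero x = 0
    dist (suc f) x with branching? x
    ... | yes _ = 0
    ... | no _ = suc (dist f (nxt x))

    dist-step : ∀ f {x} → ¬ Branching x → dist (suc f) x ≡ suc (dist f (nxt x))
    dist-step f {x} flat with branching? x
    ... | yes br = contradiction br flat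
    ... | no _ = refl

    dist-enough : ∀ f t x → t < f → Branching (walk x t) → dist (suc f) x ≡ dist f x
    dist-enough (suc f) zero x _ br with branching? x
    ... | yes _ = refl
    ... | no flat = contradiction br flat
    dist-enough (suc f) (suc t) x t<f br with branching? x
    ... | yes _ = refl
    ... | no _ = cong suc (dist-enough f t (nxt x) (s≤s⁻¹ t<f) (subst Branching (walk-shift x t) br))

module Weighting (G : Graph) (connected : Connected G) (two : AtLeastTwoCycles G)
                 (S : State G) (core : IsTwoCore G S) where

  open import Data.Nat as ℕ using (ℕ; suc)
  open import Data.Bool using (Bool; true; false; if_then_else_)
  open import Data.Fin using (Fin)
  open import Data.List using (allFin)
  open import Data.List.Membership.Propositional.Properties using (∈-allFin)
  open import Data.Product using (∃-syntax; _×_; _,_; proj₁; proj₂)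
  open import Data.Rational using (ℚ; 0ℚ; 1ℚ; _+_; _≤_; _<_)
  open import Data.Rational.Properties using (≤-refl; ≤-trans; <-trans; <-≤-trans; <⇒≤; +-mono-≤; +-monoʳ-<)
  open import Relation.Nullary using (¬_; Dec; yes; no)
  open import Relation.Binary.PropositionalEquality using (_≡_; _≢_; refl; sym; trans; cong; subst; subst₂)
  open Arcs G
  open LeafDeletion G
  open TwoCore G S (healthy-after connected (proj₁ core)) (proj₂ core)
  open RationalSums

  C D : Cycle G
  C = proj₁ two
  D = proj₁ (proj₂ two)

  reaches-branching : ∀ {y} → Alive E y → ∃[ t ] (t ℕ.< horizon × Branching (walk y t))
  reaches-branching = eventually-branching C D (cycle-alive-after C (proj₁ core))
                        (cycle-alive-after D (proj₁ core)) (proj₂ (proj₂ two))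

  -- The distance d(x); the fuel suc horizon exceeds every actual distance.
  distance : Arc → ℕ
  distance = dist (suc horizon)

  distance-decreases : ∀ x → Alive E x → ¬ Branching x → distance x ≡ suc (distance (nxt x))
  distance-decreases x ax flat with reaches-branching (nxt-alive x ax)
  ... | t , t<horizon , br = trans (dist-step horizon flat)
                                   (cong suc (sym (dist-enough horizon t (nxt x) t<horizon br)))

  weight : Arc → ℚ
  weight x = 1ℚ + halves (distance x)

  Γ : Fin (m G) → Bool → ℚ
  Γ e b = weight (e , b)

  weight-lower : ∀ x → 1ℚ ≤ weight x
  weight-lower x = x≤x+y (<⇒≤ (halves-pos (distance x)))

  weight-upper : ∀ x → weight x < 2ℚ
  weight-upper x = +-monoʳ-< 1ℚ (halves<1 (distance x))

  weight-increases : ∀ x y → distance x ≡ suc (distance y) → weight x < weight y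
  weight-increases x y d≡ = +-monoʳ-< 1ℚ (subst (λ d → halves d < halves (distance y)) (sym d≡)
                                                     (halves-decreasing (distance y)))

  -- The terms of succSum at x: the weights of the successors of x, zero elsewhere;
  -- succSum G E Γ e b is by definition pairSum (selected (e , b)) (allFin (m G)).
  selected : Arc → Fin (m G) → Bool → ℚ
  selected x e b = if succ E x (e , b) then Γ e b else 0ℚ

  selected-nonneg : ∀ x e b → 0ℚ ≤ selected x e b
  selected-nonneg x e b with succ E x (e , b)
  ... | true = ≤-trans (<⇒≤ (<-trans 0<½ ½<1)) (weight-lower (e , b))
  ... | false = ≤-refl

  selected-succ : ∀ {x z} → succ E x z ≡ true → selected x (proj₁ z) (proj₂ z) ≡ weight z
  selected-succ {x} {z} h rewrite h = refl

  successor≤sum : ∀ x z → succ E x z ≡ true → weight z ≤ succSum G E Γ (proj₁ x) (proj₂ x)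
  successor≤sum x z h = subst (_≤ pairSum (selected x) (allFin (m G))) (selected-succ {x} {z} h)
                              (term≤pairSum (selected x) (selected-nonneg x) (proj₂ z) (∈-allFin (proj₁ z)))

  two-successors≤sum : ∀ x a c → a ≢ c → succ E x a ≡ true → succ E x c ≡ true →
                       weight a + weight c ≤ succSum G E Γ (proj₁ x) (proj₂ x)
  two-successors≤sum x a c a≢c ha hc =
    subst₂ (λ p q → p + q ≤ pairSum (selected x) (allFin (m G))) (selected-succ {x} {a} ha) (selected-succ {x} {c} hc)
      (twoTerms≤pairSum (selected x) (selected-nonneg x) (proj₂ a) (proj₂ c) a≢c
                        (∈-allFin (proj₁ a)) (∈-allFin (proj₁ c)))

  -- Γ grows strictly into the non-backtracking successors: at a branching head two
  -- successors already weigh at least 2 > Γ, and otherwise the successor is one step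
  -- closer to a branching head.
  weight<succSum : ∀ x → Alive E x → weight x < succSum G E Γ (proj₁ x) (proj₂ x)
  weight<succSum x ax = by-cases (branching? x)
    where
    by-cases : Dec (Branching x) → weight x < succSum G E Γ (proj₁ x) (proj₂ x)
    by-cases (yes br) with two-successors x ax br
    ... | a , c , a≢c , ha , hc =
      <-≤-trans (weight-upper x)
        (≤-trans (+-mono-≤ (weight-lower a) (weight-lower c)) (two-successors≤sum x a c a≢c ha hc))
    by-cases (no flat) =
      <-≤-trans (weight-increases x (nxt x) (distance-decreases x ax flat)) (successor≤sum x (nxt x) (nxt-succ x ax))

open import Data.Bool using (Bool; true)
open import Data.Fin using (Fin)
open import Data.Product using (Σ-syntax; _×_; _,_; proj₂)
open import Relation.Binary.PropositionalEquality using (_≡_)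
open import Data.Rational using (ℚ; 1ℚ; _≤_; _<_)

lemma6 : (G : Graph) → Connected G → AtLeastTwoCycles G →
         (S : State G) → IsTwoCore G S →
         Σ[ Γ ∈ (Fin (m G) → Bool → ℚ) ]
           (∀ (e : Fin (m G)) (b : Bool) → proj₂ S e ≡ true →
              (1ℚ ≤ Γ e b) × (Γ e b < 2ℚ) × (Γ e b < succSum G (proj₂ S) Γ e b))
lemma6 G connected two S core =
  Γ , λ e b alive → weight-lower (e , b) , weight-upper (e , b) , weight<succSum (e , b) alive
  where open Weighting G connected two S core
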